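{- Let $M=\begin{bmatrix}1&1\\1&0\end{bmatrix}$ over $Z_3$ and let $G=Z_{16}\times Z_3\times Z_3$ with multiplication $[c,d,e][f,g,h]=[c+f \bmod 16,\; [d,e]M^{f}+[g,h] \bmod 3]$ (a group of order $144$). Let $S=\{g,g^{ -1}: g\in\{[13,0,1],[5,2,2],[10,0,2],[8,0,0]\}\}$. Then $S$ consists of exactly $7$ non-identity elements and the Cayley graph $\mathrm{Cay}(G,S)$ is a connected $7$-regular graph of diameter $3$ on $144$ vertices.
   Context: For a finite group $G$ and an inverse-closed subset $S\subseteq G$ not containing the identity, the Cayley graph $\mathrm{Cay}(G,S)$ is the undirected graph with vertex set $G$ in which $x$ and $y$ are adjacent iff $y=xs$ for some $s\in S$; it is $|S|$-regular. The diameter of a connected graph is the maximum over all pairs of vertices of the length of a shortest path between them. Here $[d,e]M^f$ denotes the row vector $[d,e]$ multiplied by the $f$-th power of the matrix $M$, computed modulo $3$; the multiplicative order of $M$ divides $16$, so this is a semidirect product of $Z_{16}$ with $Z_3\times Z_3$. -}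

module Defs where

open import Data.Nat using (ℕ; zero; suc; _+_; _*_; _∸_)
open import Data.Nat.DivMod using (_mod_)
open import Data.Fin using (Fin; toℕ)
open import Data.Fin.Properties using () renaming (_≟_ to _≟F_)
open import Data.Product using (_×_; _,_; proj₁; proj₂)
open import Data.Product.Properties using (≡-dec)
open import Data.List using (List; []; _∷_; _++_; map; filter; cartesianProduct; allFin; length)
open import Data.List.Relation.Unary.Any using (Any; any?)
open import Relation.Binary.PropositionalEquality using (_≡_)
open import Relation.Binary.Definitions using (DecidableEquality)
open import Relation.Nullary using (Dec)

_+₃_ : Fin 3 → Fin 3 → Fin 3
a +₃ b = (toℕ a + toℕ b) mod 3

-₃_ : Fin 3 → Fin 3
-₃ a = (2 * toℕ a) mod 3

_+₁₆_ : Fin 16 → Fin 16 → Fin 16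
a +₁₆ b = (toℕ a + toℕ b) mod 16

-₁₆_ : Fin 16 → Fin 16
-₁₆ a = (16 ∸ toℕ a) mod 16

V : Set
V = Fin 3 × Fin 3

-- [d,e] M  with  M = [[1,1],[1,0]]  :  [d,e]M = [d+e, d]
mulM : V → V
mulM (d , e) = (d +₃ e , d)

mulMpow : V → ℕ → V
mulMpow v zero = v
mulMpow v (suc f) = mulM (mulMpow v f)

_+V_ : V → V → V
(a , b) +V (c , d) = (a +₃ c , b +₃ d)

-V_ : V → V
-V (a , b) = (-₃ a , -₃ b)

G : Set
G = Fin 16 × V

mk : ℕ → ℕ → ℕ → G
mk c d e = (c mod 16 , (d mod 3 , e mod 3))

_·_ : G → G → G
(c , v) · (f , w) = (c +₁₆ f , mulMpow v (toℕ f) +V w)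

e : G
e = mk 0 0 0

inv : G → G
inv (c , v) = (-₁₆ c , -V (mulMpow v (toℕ (-₁₆ c))))

_≟G_ : DecidableEquality G
_≟G_ = ≡-dec _≟F_ (≡-dec _≟F_ _≟F_)

allG : List G
allG = cartesianProduct (allFin 16) (cartesianProduct (allFin 3) (allFin 3))

-- generators and the connection set S = {g, g⁻¹ : g ∈ gens} (as a list, possibly with repeats)
gens : List G
gens = mk 13 0 1 ∷ mk 5 2 2 ∷ mk 10 0 2 ∷ mk 8 0 0 ∷ []

Slist : List G
Slist = gens ++ map inv gens

Adj : G → G → Set
Adj x y = Any (λ s → y ≡ x · s) Slist

Adj? : ∀ x y → Dec (Adj x y)
Adj? x y = any? (λ s → y ≟G (x · s)) Slist

-- neighbourhood of x (each vertex of G listed once, filtered by adjacency)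
neighbours : G → List G
neighbours x = filter (Adj? x) allG

data Walk : G → G → ℕ → Set where
  here : ∀ {x} → Walk x x 0
  step : ∀ {x y z n} → Adj x y → Walk y z n → Walk x z (suc n)

{-# OPTIONS --safe #-}
-- G is the semidirect product Z₁₆ ⋉ Z₃² in which Z₁₆ acts through v ↦ vM, a linear map with
-- M¹⁶ = 1.  Associativity follows from exactly these two facts; every other claim is about a
-- group of 144 elements and is decided by evaluation.  Left multiplication is an automorphism
-- of Cay(G,S), so the diameter is the largest distance from e, and [7,0,2] is at distance 3.
module Submission where

open import Defs
open import Data.Nat using (ℕ; zero; suc; _+_; _*_; _≤_; NonZero; s≤s; s≤s⁻¹)
open import Data.Nat.Properties using (+-comm; +-assoc; ≮⇒≥; anyUpTo?) renaming (_≟_ to _≟ℕ_)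
open import Data.Nat.DivMod using (_%_; _/_; _mod_; %-distribˡ-+; m%n%n≡m%n; m≡m%n+[m/n]*n)
open import Data.Fin using (Fin; toℕ)
open import Data.Fin.Properties using (toℕ-fromℕ<; toℕ-injective; all?) renaming (_≟_ to _≟F_)
open import Data.Product using (_×_; _,_; ∃-syntax; Σ)
open import Data.Product.Properties using (≡-dec)
open import Data.List using (List; []; _∷_; length)
open import Data.List.Relation.Unary.All as All using (All)
open import Data.List.Relation.Unary.Any as Any using (Any; any?)
open import Data.List.Relation.Unary.AllPairs using (allPairs?)
open import Data.List.Relation.Unary.Unique.Propositional using (Unique)
open import Data.List.Relation.Unary.Unique.Propositional.Properties using (cartesianProduct⁺; allFin⁺)
open import Data.List.Membership.Propositional using (_∈_; find)
open import Data.List.Membership.Propositional.Properties using (∈-cartesianProduct⁺; ∈-allFin)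
open import Data.List.Membership.DecPropositional _≟G_ using (_∈?_)
open import Function.Bundles using (_⇔_; mk⇔)
open import Function.Properties.Equivalence using () renaming (sym to ⇔-sym)
open import Level using (Level)
open import Relation.Nullary using (Dec; ¬?)
open import Relation.Nullary.Decidable using (map; map′; from-yes; from-no)
open import Relation.Unary using (Pred; Decidable)
open import Relation.Binary.Definitions using (DecidableEquality)
open import Relation.Binary.PropositionalEquality using (_≡_; _≢_; refl; sym; trans; cong; cong₂; subst; subst₂; module ≡-Reasoning)
open ≡-Reasoning

module ModularAddition (n : ℕ) .{{_ : NonZero n}} where

  _⊕_ : Fin n → Fin n → Fin n
  a ⊕ b = (toℕ a + toℕ b) mod n

  toℕ-⊕ : ∀ a b → toℕ (a ⊕ b) ≡ (toℕ a + toℕ b) % n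
  toℕ-⊕ a b = toℕ-fromℕ< _

  mod-cong : ∀ {k m} → k % n ≡ m % n → k mod n ≡ m mod n
  mod-cong {k} {m} eq = toℕ-injective (trans (toℕ-fromℕ< _) (trans eq (sym (toℕ-fromℕ< _))))

  [k%n+m]%n≡[k+m]%n : ∀ k m → (k % n + m) % n ≡ (k + m) % n
  [k%n+m]%n≡[k+m]%n k m = begin
    (k % n + m) % n          ≡⟨ %-distribˡ-+ (k % n) m n ⟩
    (k % n % n + m % n) % n  ≡⟨ cong (λ t → (t + m % n) % n) (m%n%n≡m%n k n) ⟩
    (k % n + m % n) % n      ≡⟨ %-distribˡ-+ k m n ⟨
    (k + m) % n              ∎

  [k+m%n]%n≡[k+m]%n : ∀ k m → (k + m % n) % n ≡ (k + m) % n
  [k+m%n]%n≡[k+m]%n k m = begin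
    (k + m % n) % n  ≡⟨ cong (_% n) (+-comm k (m % n)) ⟩
    (m % n + k) % n  ≡⟨ [k%n+m]%n≡[k+m]%n m k ⟩
    (m + k) % n      ≡⟨ cong (_% n) (+-comm m k) ⟩
    (k + m) % n      ∎

  ⊕-comm : ∀ a b → a ⊕ b ≡ b ⊕ a
  ⊕-comm a b = cong (_mod n) (+-comm (toℕ a) (toℕ b))

  ⊕-assoc : ∀ a b c → (a ⊕ b) ⊕ c ≡ a ⊕ (b ⊕ c)
  ⊕-assoc a b c = mod-cong (begin
    (toℕ (a ⊕ b) + toℕ c) % n            ≡⟨ cong (λ t → (t + toℕ c) % n) (toℕ-⊕ a b) ⟩
    ((toℕ a + toℕ b) % n + toℕ c) % n    ≡⟨ [k%n+m]%n≡[k+m]%n (toℕ a + toℕ b) (toℕ c) ⟩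
    (toℕ a + toℕ b + toℕ c) % n          ≡⟨ cong (_% n) (+-assoc (toℕ a) (toℕ b) (toℕ c)) ⟩
    (toℕ a + (toℕ b + toℕ c)) % n        ≡⟨ [k+m%n]%n≡[k+m]%n (toℕ a) (toℕ b + toℕ c) ⟨
    (toℕ a + (toℕ b + toℕ c) % n) % n    ≡⟨ cong (λ t → (toℕ a + t) % n) (toℕ-⊕ b c) ⟨
    (toℕ a + toℕ (b ⊕ c)) % n            ∎)

  ⊕-interchange : ∀ a b c d → (a ⊕ b) ⊕ (c ⊕ d) ≡ (a ⊕ c) ⊕ (b ⊕ d)
  ⊕-interchange a b c d = begin
    (a ⊕ b) ⊕ (c ⊕ d)  ≡⟨ ⊕-assoc a b (c ⊕ d) ⟩
    a ⊕ (b ⊕ (c ⊕ d))  ≡⟨ cong (a ⊕_) (⊕-assoc b c d) ⟨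
    a ⊕ ((b ⊕ c) ⊕ d)  ≡⟨ cong (λ t → a ⊕ (t ⊕ d)) (⊕-comm b c) ⟩
    a ⊕ ((c ⊕ b) ⊕ d)  ≡⟨ cong (a ⊕_) (⊕-assoc c b d) ⟩
    a ⊕ (c ⊕ (b ⊕ d))  ≡⟨ ⊕-assoc a c (b ⊕ d) ⟨
    (a ⊕ c) ⊕ (b ⊕ d)  ∎

module Z₃ = ModularAddition 3
module Z₁₆ = ModularAddition 16

_≟V_ : DecidableEquality V
_≟V_ = ≡-dec _≟F_ _≟F_

+V-assoc : ∀ u v w → (u +V v) +V w ≡ u +V (v +V w)
+V-assoc (a , b) (c , d) (f , g) = cong₂ _,_ (Z₃.⊕-assoc a c f) (Z₃.⊕-assoc b d g)

mulM-+V : ∀ u w → mulM (u +V w) ≡ mulM u +V mulM w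
mulM-+V (a , b) (c , d) = cong (_, a +₃ c) (Z₃.⊕-interchange a c b d)

mulMpow-+V : ∀ u w n → mulMpow (u +V w) n ≡ mulMpow u n +V mulMpow w n
mulMpow-+V u w zero    = refl
mulMpow-+V u w (suc n) = trans (cong mulM (mulMpow-+V u w n)) (mulM-+V (mulMpow u n) (mulMpow w n))

mulMpow-+ : ∀ v m n → mulMpow v (m + n) ≡ mulMpow (mulMpow v n) m
mulMpow-+ v zero    n = refl
mulMpow-+ v (suc m) n = cong mulM (mulMpow-+ v m n)

module Periodic (p : ℕ) .{{_ : NonZero p}} (period : ∀ v → mulMpow v p ≡ v) where

  mulMpow-*p : ∀ v q → mulMpow v (q * p) ≡ v
  mulMpow-*p v zero    = refl
  mulMpow-*p v (suc q) = begin
    mulMpow v (p + q * p)            ≡⟨ mulMpow-+ v p (q * p) ⟩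
    mulMpow (mulMpow v (q * p)) p    ≡⟨ period (mulMpow v (q * p)) ⟩
    mulMpow v (q * p)                ≡⟨ mulMpow-*p v q ⟩
    v                                ∎

  mulMpow-%p : ∀ v n → mulMpow v (n % p) ≡ mulMpow v n
  mulMpow-%p v n = begin
    mulMpow v (n % p)                        ≡⟨ cong (λ w → mulMpow w (n % p)) (mulMpow-*p v (n / p)) ⟨
    mulMpow (mulMpow v (n / p * p)) (n % p)  ≡⟨ mulMpow-+ v (n % p) (n / p * p) ⟨
    mulMpow v (n % p + n / p * p)            ≡⟨ cong (mulMpow v) (m≡m%n+[m/n]*n n p) ⟨
    mulMpow v n                              ∎

M¹⁶≡1 : ∀ v → mulMpow v 16 ≡ v
M¹⁶≡1 (a , b) = from-yes (all? λ a → all? λ b → mulMpow (a , b) 16 ≟V (a , b)) a b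

open Periodic 16 M¹⁶≡1 using (mulMpow-%p)

mulMpow-+₁₆ : ∀ v f h → mulMpow v (toℕ (f +₁₆ h)) ≡ mulMpow (mulMpow v (toℕ f)) (toℕ h)
mulMpow-+₁₆ v f h = begin
  mulMpow v (toℕ (f +₁₆ h))             ≡⟨ cong (mulMpow v) (Z₁₆.toℕ-⊕ f h) ⟩
  mulMpow v ((toℕ f + toℕ h) % 16)      ≡⟨ mulMpow-%p v (toℕ f + toℕ h) ⟩
  mulMpow v (toℕ f + toℕ h)             ≡⟨ cong (mulMpow v) (+-comm (toℕ f) (toℕ h)) ⟩
  mulMpow v (toℕ h + toℕ f)             ≡⟨ mulMpow-+ v (toℕ h) (toℕ f) ⟩
  mulMpow (mulMpow v (toℕ f)) (toℕ h)   ∎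

·-assoc : ∀ x y z → (x · y) · z ≡ x · (y · z)
·-assoc (c , v) (f , w) (h , u) = cong₂ _,_ (Z₁₆.⊕-assoc c f h) (begin
  mulMpow (mulMpow v (toℕ f) +V w) (toℕ h) +V u
    ≡⟨ cong (_+V u) (mulMpow-+V (mulMpow v (toℕ f)) w (toℕ h)) ⟩
  (mulMpow (mulMpow v (toℕ f)) (toℕ h) +V mulMpow w (toℕ h)) +V u
    ≡⟨ +V-assoc (mulMpow (mulMpow v (toℕ f)) (toℕ h)) (mulMpow w (toℕ h)) u ⟩
  mulMpow (mulMpow v (toℕ f)) (toℕ h) +V (mulMpow w (toℕ h) +V u)
    ≡⟨ cong (_+V (mulMpow w (toℕ h) +V u)) (mulMpow-+₁₆ v f h) ⟨
  mulMpow v (toℕ (f +₁₆ h)) +V (mulMpow w (toℕ h) +V u)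
    ∎)

module _ {a p : Level} {A : Set a} {P : Pred A p} (xs : List A) (complete : ∀ x → x ∈ xs) where

  all?-by-enumeration : Decidable P → Dec (∀ x → P x)
  all?-by-enumeration P? =
    map′ (λ Pxs x → All.lookup Pxs (complete x)) (λ ∀P → All.tabulate (λ {x} _ → ∀P x)) (All.all? P? xs)

∈-allG : ∀ x → x ∈ allG
∈-allG (c , a , b) = ∈-cartesianProduct⁺ (∈-allFin c) (∈-cartesianProduct⁺ (∈-allFin a) (∈-allFin b))

allG-unique : Unique allG
allG-unique = cartesianProduct⁺ (allFin⁺ 16) (cartesianProduct⁺ (allFin⁺ 3) (allFin⁺ 3))

allG? : {p : Level} {P : Pred G p} → Decidable P → Dec (∀ x → P x)
allG? = all?-by-enumeration allG ∈-allG

·-identityˡ : ∀ x → e · x ≡ x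
·-identityˡ = from-yes (allG? (λ x → (e · x) ≟G x))

·-identityʳ : ∀ x → x · e ≡ x
·-identityʳ = from-yes (allG? (λ x → (x · e) ≟G x))

·-inverseʳ : ∀ x → x · inv x ≡ e
·-inverseʳ = from-yes (allG? (λ x → (x · inv x) ≟G e))

·-inverseˡ : ∀ x → inv x · x ≡ e
·-inverseˡ = from-yes (allG? (λ x → (inv x · x) ≟G e))

·-cancel-inv : ∀ x y → x · (inv x · y) ≡ y
·-cancel-inv x y = begin
  x · (inv x · y)  ≡⟨ ·-assoc x (inv x) y ⟨
  (x · inv x) · y  ≡⟨ cong (_· y) (·-inverseʳ x) ⟩
  e · y            ≡⟨ ·-identityˡ y ⟩
  y                ∎

Adj-translate : ∀ g {x y} → Adj x y → Adj (g · x) (g · y)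
Adj-translate g {x} = Any.map (λ {s} y≡xs → trans (cong (g ·_) y≡xs) (sym (·-assoc g x s)))

Walk-translate : ∀ g {x y n} → Walk x y n → Walk (g · x) (g · y) n
Walk-translate g here       = here
Walk-translate g (step a w) = step (Adj-translate g a) (Walk-translate g w)

Walk-suc⇔ : ∀ {x z n} → Walk x z (suc n) ⇔ Any (λ s → Walk (x · s) z n) Slist
Walk-suc⇔ {x} {z} {n} = mk⇔
  (λ { (step adj w) → Any.map (λ y≡xs → subst (λ t → Walk t z n) y≡xs w) adj })
  (λ walks → let (s , s∈S , w) = find walks in step (Any.map (cong (x ·_)) s∈S) w)

Walk? : ∀ x y n → Dec (Walk x y n)
Walk? x y zero    = map′ (λ { refl → here }) (λ { here → refl }) (x ≟G y)
Walk? x y (suc n) = map (⇔-sym Walk-suc⇔) (any? (λ s → Walk? (x · s) y n) Slist)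

Within : G → G → ℕ → Set
Within x y d = ∃[ n ] (n ≤ d × Walk x y n)

Within? : ∀ x y d → Dec (Within x y d)
Within? x y d = map′ (λ (n , n<1+d , w) → n , s≤s⁻¹ n<1+d , w) (λ (n , n≤d , w) → n , s≤s n≤d , w)
  (anyUpTo? (Walk? x y) (suc d))

Within-from-e : ∀ d → (∀ z → Within e z d) → ∀ x y → Within x y d
Within-from-e d near x y =
  let (n , n≤d , w) = near (inv x · y)
  in n , n≤d , subst₂ (λ a b → Walk a b n) (·-identityʳ x) (·-cancel-inv x y) (Walk-translate x w)

diameter≤3 : ∀ x y → Within x y 3
diameter≤3 = Within-from-e 3 (from-yes (allG? (λ z → Within? e z 3)))

far : G
far = mk 7 0 2

distance-e-far≥3 : ∀ n → Walk e far n → 3 ≤ n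
distance-e-far≥3 n w = ≮⇒≥ (λ n<3 → from-no (Within? e far 2) (n , s≤s⁻¹ n<3 , w))

degree≡7 : ∀ x → length (neighbours x) ≡ 7
degree≡7 = from-yes (allG? (λ x → length (neighbours x) ≟ℕ 7))

-- [8,0,0] is an involution; the other three generators are listed with their inverses.
S : List G
S = mk 13 0 1 ∷ mk 5 2 2 ∷ mk 10 0 2 ∷ mk 8 0 0 ∷ mk 3 1 2 ∷ mk 11 2 0 ∷ mk 6 2 2 ∷ []

S-unique : Unique S
S-unique = from-yes (allPairs? (λ x y → ¬? (x ≟G y)) S)

S⇔Slist : ∀ z → z ∈ S ⇔ z ∈ Slist
S⇔Slist z = mk⇔ (All.lookup (from-yes (All.all? (_∈? Slist) S)))
                (All.lookup (from-yes (All.all? (_∈? S) Slist)))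

S-nonidentity : All (_≢ e) S
S-nonidentity = from-yes (All.all? (λ z → ¬? (z ≟G e)) S)

mainTheorem12 :
    -- G is a group of order 144 (allG lists every element exactly once)
    ((∀ x y z → (x · y) · z ≡ x · (y · z))
      × (∀ x → (e · x ≡ x) × (x · e ≡ x))
      × (∀ x → (x · inv x ≡ e) × (inv x · x ≡ e))
      × (∀ x → x ∈ allG) × Unique allG × length allG ≡ 144)
    -- S consists of exactly 7 non-identity elements
    × (Σ (List G) λ L → length L ≡ 7 × Unique L × (∀ z → (z ∈ L) ⇔ (z ∈ Slist)) × All (λ z → z ≢ e) L)
    -- Cay(G,S) is connected
    × (∀ x y → ∃[ n ] Walk x y n)
    -- 7-regular
    × (∀ x → length (neighbours x) ≡ 7)
    -- diameter 3
    × (∀ x y → ∃[ n ] (n ≤ 3 × Walk x y n))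
    × (∃[ x ] ∃[ y ] (∀ n → Walk x y n → 3 ≤ n))
mainTheorem12 =
  ( (·-assoc , (λ x → ·-identityˡ x , ·-identityʳ x) , (λ x → ·-inverseʳ x , ·-inverseˡ x)
    , ∈-allG , allG-unique , refl)
  , (S , refl , S-unique , S⇔Slist , S-nonidentity)
  , (λ x y → let (n , _ , w) = diameter≤3 x y in n , w)
  , degree≡7
  , diameter≤3
  , (e , far , distance-e-far≥3))
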